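{- The pattern \[ \begin{bmatrix} 1&1&0&0\\ 0&1&1&1\\ 0&0&1&0\\ 0&0&0&1\end{bmatrix}\] allows a real matrix (i.e., there is a real matrix with this pattern) that has the SSVP and a multiple singular value.
   Context: A real matrix has a given $\{0,1\}$-pattern if its $(i,j)$ entry is nonzero exactly when the $(i,j)$ entry of the pattern is $1$. The singular values of a real $m\times n$ matrix $A$ are the nonnegative square roots of the eigenvalues of $AA^T$, as a multiset; a multiple singular value is one of multiplicity at least $2$. A real $m\times n$ matrix $A$ has the SSVP if the zero matrix is the only $m\times n$ matrix $X$ with $A^TX$ symmetric, $XA^T$ symmetric, and $A\circ X=O$ (entrywise product). -}

module Defs where

open import Data.Nat using (ℕ; zero; suc)
open import Data.Fin using (Fin; zero; suc; punchIn)
open import Data.Bool using (Bool; true; false)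
open import Data.Vec using (Vec; []; _∷_; lookup)
open import Data.Product using (Σ; ∃; _×_; _,_)
open import Data.Sum using (_⊎_)
open import Relation.Binary.PropositionalEquality using (_≡_; _≢_)
open import Relation.Binary.Structures using (IsStrictTotalOrder)
open import Algebra.Structures using (IsCommutativeRing)

-- The real numbers, axiomatised as a complete ordered field
-- (any two such structures are isomorphic, so quantifying over all of
-- them is the same as speaking about ℝ).

record RealField : Set₁ where
  infixl 6 _+_
  infixl 7 _*_
  infix  4 _<_ _≤_
  field
    Carrier : Set
    0ℝ 1ℝ   : Carrier
    _+_ _*_ : Carrier → Carrier → Carrier
    -_      : Carrier → Carrier
    isCommutativeRing : IsCommutativeRing _≡_ _+_ _*_ -_ 0ℝ 1ℝ
    0≢1     : 0ℝ ≢ 1ℝ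
    inverse : ∀ x → x ≢ 0ℝ → ∃ λ y → x * y ≡ 1ℝ
    _<_     : Carrier → Carrier → Set
    isStrictTotalOrder : IsStrictTotalOrder _≡_ _<_
    +-mono-< : ∀ {x y} z → x < y → x + z < y + z
    *-pos    : ∀ {x y} → 0ℝ < x → 0ℝ < y → 0ℝ < x * y

  _≤_ : Carrier → Carrier → Set
  x ≤ y = x < y ⊎ x ≡ y

  IsUpperBound : (Carrier → Set) → Carrier → Set
  IsUpperBound S b = ∀ x → S x → x ≤ b

  IsLeastUpperBound : (Carrier → Set) → Carrier → Set
  IsLeastUpperBound S s = IsUpperBound S s × (∀ b → IsUpperBound S b → s ≤ b)

  field
    complete : (S : Carrier → Set) → (∃ λ x → S x) → (∃ λ b → IsUpperBound S b) →
               ∃ λ s → IsLeastUpperBound S s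

module Matrices (R : RealField) where
  open RealField R

  Matrix : ℕ → ℕ → Set
  Matrix m n = Fin m → Fin n → Carrier

  sumF : ∀ {n} → (Fin n → Carrier) → Carrier
  sumF {zero}  f = 0ℝ
  sumF {suc n} f = f zero + sumF (λ k → f (suc k))

  _ᵀ : ∀ {m n} → Matrix m n → Matrix n m
  (A ᵀ) i j = A j i

  _·_ : ∀ {m n p} → Matrix m n → Matrix n p → Matrix m p
  (A · B) i j = sumF (λ k → A i k * B k j)

  _∘ₕ_ : ∀ {m n} → Matrix m n → Matrix m n → Matrix m n
  (A ∘ₕ B) i j = A i j * B i j

  IsZero : ∀ {m n} → Matrix m n → Set
  IsZero X = ∀ i j → X i j ≡ 0ℝ

  Symmetric : ∀ {n} → Matrix n n → Set
  Symmetric M = ∀ i j → M i j ≡ M j i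

  HasPattern : ∀ {m n} → Matrix m n → (Fin m → Fin n → Bool) → Set
  HasPattern A P = ∀ i j → (P i j ≡ true → A i j ≢ 0ℝ) × (P i j ≡ false → A i j ≡ 0ℝ)

  SSVP : ∀ {m n} → Matrix m n → Set
  SSVP {m} {n} A = (X : Matrix m n) → Symmetric ((A ᵀ) · X) → Symmetric (X · (A ᵀ))
                   → IsZero (A ∘ₕ X) → IsZero X

  sign : ℕ → Carrier
  sign zero    = 1ℝ
  sign (suc k) = - sign k

  toℕ' : ∀ {n} → Fin n → ℕ
  toℕ' zero    = zero
  toℕ' (suc i) = suc (toℕ' i)

  det : ∀ {n} → Matrix n n → Carrier
  det {zero}  M = 1ℝ
  det {suc n} M = sumF (λ j → sign (toℕ' j) * M zero j * det (λ r c → M (suc r) (punchIn j c)))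

  identity : ∀ {n} → Matrix n n
  identity zero    zero    = 1ℝ
  identity zero    (suc j) = 0ℝ
  identity (suc i) zero    = 0ℝ
  identity (suc i) (suc j) = identity i j

  charPoly : ∀ {n} → Matrix n n → Carrier → Carrier
  charPoly M t = det (λ i j → t * identity i j + - M i j)

  -- λ is a root of multiplicity ≥ 2 of the (monic, degree n+2) characteristic
  -- polynomial of M:  charPoly M = (x − λ)² · q  for a monic polynomial q of
  -- degree n, given by its lower coefficients c₀ … c_{n-1}.
  evalMonic : ∀ {n} → Vec Carrier n → Carrier → Carrier
  evalMonic []       t = 1ℝ
  evalMonic (c ∷ cs) t = c + t * evalMonic cs t

  MultipleEigenvalue : ∀ {n} → Matrix (suc (suc n)) (suc (suc n)) → Carrier → Set
  MultipleEigenvalue {n} M λ₀ =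
    ∃ λ (q : Vec Carrier n) → ∀ t →
      charPoly M t ≡ (t + - λ₀) * (t + - λ₀) * evalMonic q t

  HasMultipleSingularValue : ∀ {m n} → Matrix (suc (suc m)) n → Set
  HasMultipleSingularValue A =
    ∃ λ σ → 0ℝ ≤ σ × MultipleEigenvalue (A · (A ᵀ)) (σ * σ)

patternRows : Vec (Vec Bool 4) 4
patternRows = (true  ∷ true  ∷ false ∷ false ∷ [])
            ∷ (false ∷ true  ∷ true  ∷ true  ∷ [])
            ∷ (false ∷ false ∷ true  ∷ false ∷ [])
            ∷ (false ∷ false ∷ false ∷ true  ∷ [])
            ∷ []

pattern4 : Fin 4 → Fin 4 → Bool
pattern4 i j = lookup (lookup patternRows i) j

-- A = [[3,4,0,0],[0,1,1,1],[0,0,5,0],[0,0,0,5]] has the pattern, and A Aᵀ has characteristic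
-- polynomial (t − 25)²(t² − 28t + 9), so 5 is a double singular value. For the SSVP, A ∘ X = 0
-- leaves nine unknown entries of X (indexed from 0), and the symmetry of AᵀX and XAᵀ gives
-- x₁₀ = 0, x₀₂ + x₀₃ = 3x₁₀, 4x₀₂ = 5x₂₁, 4x₀₃ = 5x₃₁, x₂₁ + x₂₃ = 0 = x₃₁ + x₃₂, x₂₃ = x₃₂,
-- 3x₀₂ = x₁₀ + 5x₂₀ and 3x₀₃ = x₁₀ + 5x₃₀. Hence 4x₀₂ = 5x₂₁ = −5x₂₃ = −5x₃₂ = 5x₃₁ = 4x₀₃,
-- so x₀₂ = x₀₃ = −x₀₂ = 0, and the other unknowns vanish in turn. Identities with integer
-- coefficients are verified by the ring solver over ℤ, via the canonical homomorphism ℤ → ℝ.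

module Submission where

open import Algebra.Bundles using (CommutativeRing)
open import Data.Bool.Base using (Bool; true; false; if_then_else_)
open import Data.Bool.Properties using (if-float)
open import Data.Fin.Base using (Fin; zero; suc; punchIn; combine; remQuot)
open import Data.Fin.Patterns using (0F; 1F; 2F; 3F)
open import Data.Fin.Properties using (remQuot-combine)
open import Data.Integer.Base as ℤ using (ℤ; +_; -[1+_]; +[1+_]; _⊖_; 0ℤ; 1ℤ)
import Data.Integer.Properties as ℤ
open import Data.Integer.Tactic.RingSolver using (solve-∀)
import Data.Maybe.Base as Maybe
open import Data.Nat.Base as ℕ using (ℕ; zero; suc)
open import Data.Product.Base using (∃; ∃₂; _×_; _,_; proj₁; uncurry)
open import Data.Sum.Base using (inj₁)
open import Data.Vec.Base using (Vec; []; _∷_; lookup; map; tabulate)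
open import Data.Vec.Properties using (lookup-map; lookup∘tabulate)
open import Defs
open import Function.Base using (_∘_)
open import Level using (Level)
open import Relation.Binary.Definitions using (tri<; tri≈; tri>)
open import Relation.Binary.PropositionalEquality as ≡ using (_≡_; _≢_; cong₂)
open import Relation.Binary.Structures using (IsStrictTotalOrder)
open import Relation.Nullary.Decidable.Core using (dec⇒maybe)
open import Relation.Nullary.Negation.Core using (contradiction)

⊖-surjective : ∀ i → ∃₂ λ m n → m ⊖ n ≡ i
⊖-surjective (+ n)    = n , 0 , ≡.refl
⊖-surjective -[1+ n ] = 0 , suc n , ≡.refl

⊖-+-⊖ : ∀ a b c d → (a ⊖ b) ℤ.+ (c ⊖ d) ≡ (a ℕ.+ c) ⊖ (b ℕ.+ d)
⊖-+-⊖ a b c d = begin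
  (a ⊖ b) ℤ.+ (c ⊖ d)              ≡⟨ cong₂ ℤ._+_ (ℤ.[+m]-[+n]≡m⊖n a b) (ℤ.[+m]-[+n]≡m⊖n c d) ⟨
  (+ a ℤ.- + b) ℤ.+ (+ c ℤ.- + d)  ≡⟨ rearrange (+ a) (+ b) (+ c) (+ d) ⟩
  (+ a ℤ.+ + c) ℤ.- (+ b ℤ.+ + d)  ≡⟨ cong₂ ℤ._-_ (ℤ.pos-+ a c) (ℤ.pos-+ b d) ⟨
  + (a ℕ.+ c) ℤ.- + (b ℕ.+ d)      ≡⟨ ℤ.[+m]-[+n]≡m⊖n (a ℕ.+ c) (b ℕ.+ d) ⟩
  (a ℕ.+ c) ⊖ (b ℕ.+ d)            ∎
  where
  open ≡.≡-Reasoning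
  rearrange : ∀ w x y z → (w ℤ.- x) ℤ.+ (y ℤ.- z) ≡ (w ℤ.+ y) ℤ.- (x ℤ.+ z)
  rearrange = solve-∀

module IntegerCoefficients {c ℓ : Level} (R : CommutativeRing c ℓ) where

  open CommutativeRing R
  open import Algebra.Properties.Semiring.Mult.TCOptimised semiring
    using (1+×; ×-homo-+) renaming (_×_ to _×′_)
  open import Algebra.Properties.Ring ring using (-‿distribˡ-*; -‿involutive; -0#≈0#)
  open import Algebra.Properties.AbelianGroup +-abelianGroup using (⁻¹-∙-comm)
  open import Algebra.Properties.CommutativeSemigroup +-commutativeSemigroup using (interchange)
  open import Algebra.Solver.Ring.AlmostCommutativeRing using (fromCommutativeRing; _-Raw-AlmostCommutative⟶_)
  open import Relation.Binary.Reasoning.Setoid setoid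

  [w+x]-[y+z]≈[w-y]+[x-z] : ∀ w x y z → (w + x) - (y + z) ≈ (w - y) + (x - z)
  [w+x]-[y+z]≈[w-y]+[x-z] w x y z = trans (+-congˡ (sym (⁻¹-∙-comm y z))) (interchange w x (- y) (- z))

  -- `_×′_` rather than `_×_`, so that fromℕ 0 and fromℕ 1 are literally 0# and 1#.
  fromℕ : ℕ → Carrier
  fromℕ n = n ×′ 1#

  fromℤ : ℤ → Carrier
  fromℤ (+ n)    = fromℕ n
  fromℤ -[1+ n ] = - fromℕ (suc n)

  fromℤ-⊖ : ∀ m n → fromℤ (m ⊖ n) ≈ fromℕ m - fromℕ n
  fromℤ-⊖ m       zero    = sym (trans (+-congˡ -0#≈0#) (+-identityʳ _))
  fromℤ-⊖ zero    (suc n) = sym (+-identityˡ _)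
  fromℤ-⊖ (suc m) (suc n) = begin
    fromℤ (suc m ⊖ suc n)                  ≡⟨ ≡.cong fromℤ (ℤ.[1+m]⊖[1+n]≡m⊖n m n) ⟩
    fromℤ (m ⊖ n)                          ≈⟨ fromℤ-⊖ m n ⟩
    fromℕ m - fromℕ n                      ≈⟨ +-identityˡ _ ⟨
    0# + (fromℕ m - fromℕ n)               ≈⟨ +-congʳ (-‿inverseʳ 1#) ⟨
    (1# - 1#) + (fromℕ m - fromℕ n)        ≈⟨ [w+x]-[y+z]≈[w-y]+[x-z] 1# (fromℕ m) 1# (fromℕ n) ⟨
    (1# + fromℕ m) - (1# + fromℕ n)        ≈⟨ +-cong (1+× m 1#) (-‿cong (1+× n 1#)) ⟨
    fromℕ (suc m) - fromℕ (suc n)          ∎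

  fromℤ-+ : ∀ i j → fromℤ (i ℤ.+ j) ≈ fromℤ i + fromℤ j
  fromℤ-+ i j with ⊖-surjective i | ⊖-surjective j
  ... | a , b , ≡.refl | c , d , ≡.refl = begin
    fromℤ ((a ⊖ b) ℤ.+ (c ⊖ d))                ≡⟨ ≡.cong fromℤ (⊖-+-⊖ a b c d) ⟩
    fromℤ ((a ℕ.+ c) ⊖ (b ℕ.+ d))              ≈⟨ fromℤ-⊖ (a ℕ.+ c) (b ℕ.+ d) ⟩
    fromℕ (a ℕ.+ c) - fromℕ (b ℕ.+ d)          ≈⟨ +-cong (×-homo-+ 1# a c) (-‿cong (×-homo-+ 1# b d)) ⟩
    (fromℕ a + fromℕ c) - (fromℕ b + fromℕ d)  ≈⟨ [w+x]-[y+z]≈[w-y]+[x-z] _ _ _ _ ⟩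
    (fromℕ a - fromℕ b) + (fromℕ c - fromℕ d)  ≈⟨ +-cong (fromℤ-⊖ a b) (fromℤ-⊖ c d) ⟨
    fromℤ (a ⊖ b) + fromℤ (c ⊖ d)              ∎

  fromℤ-neg : ∀ i → fromℤ (ℤ.- i) ≈ - fromℤ i
  fromℤ-neg (+ zero)  = sym -0#≈0#
  fromℤ-neg +[1+ n ]  = refl
  fromℤ-neg -[1+ n ]  = sym (-‿involutive _)

  fromℤ-+* : ∀ n j → fromℤ (+ n ℤ.* j) ≈ fromℕ n * fromℤ j
  fromℤ-+* zero    j = begin
    fromℤ (+ 0 ℤ.* j)  ≡⟨ ≡.cong fromℤ (ℤ.*-zeroˡ j) ⟩
    0#                 ≈⟨ zeroˡ (fromℤ j) ⟨
    0# * fromℤ j       ∎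
  fromℤ-+* (suc n) j = begin
    fromℤ (+ suc n ℤ.* j)           ≡⟨ ≡.cong fromℤ (ℤ.suc-* (+ n) j) ⟩
    fromℤ (j ℤ.+ + n ℤ.* j)         ≈⟨ fromℤ-+ j (+ n ℤ.* j) ⟩
    fromℤ j + fromℤ (+ n ℤ.* j)     ≈⟨ +-cong (sym (*-identityˡ _)) (fromℤ-+* n j) ⟩
    1# * fromℤ j + fromℕ n * fromℤ j ≈⟨ distribʳ (fromℤ j) 1# (fromℕ n) ⟨
    (1# + fromℕ n) * fromℤ j        ≈⟨ *-congʳ (1+× n 1#) ⟨
    fromℕ (suc n) * fromℤ j         ∎

  fromℤ-* : ∀ i j → fromℤ (i ℤ.* j) ≈ fromℤ i * fromℤ j
  fromℤ-* (+ n)    j = fromℤ-+* n j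
  fromℤ-* -[1+ n ] j = begin
    fromℤ (ℤ.- (+ suc n) ℤ.* j)       ≡⟨ ≡.cong fromℤ (ℤ.neg-distribˡ-* (+ suc n) j) ⟨
    fromℤ (ℤ.- (+ suc n ℤ.* j))       ≈⟨ fromℤ-neg (+ suc n ℤ.* j) ⟩
    - fromℤ (+ suc n ℤ.* j)           ≈⟨ -‿cong (fromℤ-+* (suc n) j) ⟩
    - (fromℕ (suc n) * fromℤ j)       ≈⟨ -‿distribˡ-* (fromℕ (suc n)) (fromℤ j) ⟩
    - fromℕ (suc n) * fromℤ j         ∎

  fromℤ-homomorphism : ℤ.+-*-rawRing -Raw-AlmostCommutative⟶ fromCommutativeRing R
  fromℤ-homomorphism = record
    { ⟦_⟧    = fromℤ
    ; +-homo = fromℤ-+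
    ; *-homo = fromℤ-*
    ; -‿homo = fromℤ-neg
    ; 0-homo = refl
    ; 1-homo = refl
    }

  open import Algebra.Solver.Ring ℤ.+-*-rawRing (fromCommutativeRing R) fromℤ-homomorphism
    (λ i j → Maybe.map (reflexive ∘ ≡.cong fromℤ) (dec⇒maybe (i ℤ.≟ j))) public

module RealFieldProperties (ℝ : RealField) where

  open RealField ℝ

  commutativeRing : CommutativeRing _ _
  commutativeRing = record
    { Carrier = Carrier ; _≈_ = _≡_ ; _+_ = _+_ ; _*_ = _*_ ; -_ = -_ ; 0# = 0ℝ ; 1# = 1ℝ
    ; isCommutativeRing = isCommutativeRing
    }

  open IntegerCoefficients commutativeRing public
  open CommutativeRing commutativeRing
    using (+-identityˡ; -‿inverseʳ; *-identityˡ; zeroʳ; *-assoc; *-comm; distribʳ; ring)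
  open import Algebra.Properties.Ring ring using (-1*x≈-x; -‿involutive)
  private module < = IsStrictTotalOrder isStrictTotalOrder

  0<1 : 0ℝ < 1ℝ
  0<1 with <.compare 0ℝ 1ℝ
  ... | tri< 0<1 _ _ = 0<1
  ... | tri≈ _ 0≡1 _ = contradiction 0≡1 0≢1
  ... | tri> _ _ 1<0 = contradiction (<.trans 1<0 0<[-1]*[-1]) (<.irrefl ≡.refl)
    where
    0<-1 : 0ℝ < - 1ℝ
    0<-1 = ≡.subst₂ _<_ (-‿inverseʳ 1ℝ) (+-identityˡ (- 1ℝ)) (+-mono-< (- 1ℝ) 1<0)
    0<[-1]*[-1] : 0ℝ < 1ℝ
    0<[-1]*[-1] = ≡.subst (0ℝ <_) (≡.trans (-1*x≈-x (- 1ℝ)) (-‿involutive 1ℝ)) (*-pos 0<-1 0<-1)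

  0<fromℕ-suc : ∀ n → 0ℝ < fromℕ (suc n)
  0<fromℕ-suc zero    = 0<1
  0<fromℕ-suc (suc n) =
    <.trans 0<1 (≡.subst (_< fromℕ (suc n) + 1ℝ) (+-identityˡ 1ℝ) (+-mono-< 1ℝ (0<fromℕ-suc n)))

  fromℕ-suc≢0 : ∀ n → fromℕ (suc n) ≢ 0ℝ
  fromℕ-suc≢0 n eq = <.irrefl (≡.sym eq) (0<fromℕ-suc n)

  *-cancelˡ : ∀ {a x y} → a ≢ 0ℝ → a * x ≡ a * y → x ≡ y
  *-cancelˡ {a} {x} {y} a≢0 ax≡ay with inverse a a≢0
  ... | b , ab≡1 = begin
    x            ≡⟨ *-identityˡ x ⟨
    1ℝ * x       ≡⟨ ≡.cong (_* x) ba≡1 ⟨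
    b * a * x    ≡⟨ *-assoc b a x ⟩
    b * (a * x)  ≡⟨ ≡.cong (b *_) ax≡ay ⟩
    b * (a * y)  ≡⟨ *-assoc b a y ⟨
    b * a * y    ≡⟨ ≡.cong (_* y) ba≡1 ⟩
    1ℝ * y       ≡⟨ *-identityˡ y ⟩
    y            ∎
    where
    open ≡.≡-Reasoning
    ba≡1 : b * a ≡ 1ℝ
    ba≡1 = ≡.trans (*-comm b a) ab≡1

  a*x≡0⇒x≡0 : ∀ {a x} → a ≢ 0ℝ → a * x ≡ 0ℝ → x ≡ 0ℝ
  a*x≡0⇒x≡0 {a} a≢0 ax≡0 = *-cancelˡ a≢0 (≡.trans ax≡0 (≡.sym (zeroʳ a)))

  x≡0⇒a*x≡0 : ∀ a {x} → x ≡ 0ℝ → a * x ≡ 0ℝ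
  x≡0⇒a*x≡0 a x≡0 = ≡.trans (≡.cong (a *_) x≡0) (zeroʳ a)

  x+x≡0⇒x≡0 : ∀ {x} → x + x ≡ 0ℝ → x ≡ 0ℝ
  x+x≡0⇒x≡0 {x} x+x≡0 = a*x≡0⇒x≡0 (fromℕ-suc≢0 1) (begin
    (1ℝ + 1ℝ) * x    ≡⟨ distribʳ x 1ℝ 1ℝ ⟩
    1ℝ * x + 1ℝ * x  ≡⟨ ≡.cong₂ _+_ (*-identityˡ x) (*-identityˡ x) ⟩
    x + x            ≡⟨ x+x≡0 ⟩
    0ℝ               ∎)
    where open ≡.≡-Reasoning

module MatrixProperties (ℝ : RealField) where

  open RealField ℝ
  open Matrices ℝ
  open RealFieldProperties ℝ

  sumF-cong : ∀ {n} {f g : Fin n → Carrier} → (∀ k → f k ≡ g k) → sumF f ≡ sumF g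
  sumF-cong {zero}  f≗g = ≡.refl
  sumF-cong {suc n} f≗g = ≡.cong₂ _+_ (f≗g zero) (sumF-cong (f≗g ∘ suc))

  ·-congˡ : ∀ {m n p} {M M′ : Matrix m n} (N : Matrix n p) →
            (∀ i j → M i j ≡ M′ i j) → ∀ i j → (M · N) i j ≡ (M′ · N) i j
  ·-congˡ N M≗M′ i j = sumF-cong (λ k → ≡.cong (_* N k j) (M≗M′ i k))

  ·-congʳ : ∀ {m n p} (M : Matrix m n) {N N′ : Matrix n p} →
            (∀ i j → N i j ≡ N′ i j) → ∀ i j → (M · N) i j ≡ (M · N′) i j
  ·-congʳ M N≗N′ i j = sumF-cong (λ k → ≡.cong (M i k *_) (N≗N′ k j))

  Symmetric-resp : ∀ {n} {M N : Matrix n n} → (∀ i j → M i j ≡ N i j) → Symmetric M → Symmetric N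
  Symmetric-resp M≗N M-sym i j = ≡.trans (≡.sym (M≗N i j)) (≡.trans (M-sym i j) (M≗N j i))

  HasPattern-resp : ∀ {m n} {A : Matrix m n} {P Q : Fin m → Fin n → Bool} →
                    (∀ i j → P i j ≡ Q i j) → HasPattern A P → HasPattern A Q
  HasPattern-resp {P = P} {Q} P≗Q A-P i j with P i j | Q i j | P≗Q i j | A-P i j
  ... | _ | _ | ≡.refl | A-Pij = A-Pij

  fromℕ-hasPattern : ∀ {m n} (E : Fin m → Fin n → ℕ) →
                     HasPattern (λ i j → fromℕ (E i j)) (λ i j → 0 ℕ.<ᵇ E i j)
  fromℕ-hasPattern E i j with E i j
  ... | zero  = (λ ()) , (λ _ → ≡.refl)
  ... | suc n = (λ _ → fromℕ-suc≢0 n) , (λ ())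

  offSupport : ∀ {m n} → (Fin m → Fin n → Bool) → Matrix m n → Matrix m n
  offSupport P X i j = if P i j then 0ℝ else X i j

  offSupport-exact : ∀ {m n} {A X : Matrix m n} {P} → HasPattern A P → IsZero (A ∘ₕ X) →
                     ∀ i j → X i j ≡ offSupport P X i j
  offSupport-exact {P = P} A-P A∘X≡0 i j with P i j in Pij
  ... | true  = a*x≡0⇒x≡0 (proj₁ (A-P i j) Pij) (A∘X≡0 i j)
  ... | false = ≡.refl

  -- Syntactic copies of the operations of Defs.Matrices. At every fixed size, ⟦_⟧ of each is
  -- definitionally the original operation on the evaluated entries, so the ring solver can
  -- normalise determinants and products of concrete matrices with `refl`.

  PolyMatrix : ℕ → ℕ → ℕ → Set
  PolyMatrix k m n = Fin m → Fin n → Polynomial k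

  sumₚ : ∀ {k n} → (Fin n → Polynomial k) → Polynomial k
  sumₚ {n = zero}  f = con 0ℤ
  sumₚ {n = suc n} f = f zero :+ sumₚ (f ∘ suc)

  _ᵀₚ : ∀ {k m n} → PolyMatrix k m n → PolyMatrix k n m
  (M ᵀₚ) i j = M j i

  _·ₚ_ : ∀ {k m n p} → PolyMatrix k m n → PolyMatrix k n p → PolyMatrix k m p
  (M ·ₚ N) i j = sumₚ (λ l → M i l :* N l j)

  signₚ : ∀ {k} → ℕ → Polynomial k
  signₚ zero    = con 1ℤ
  signₚ (suc l) = :- signₚ l

  detₚ : ∀ {k n} → PolyMatrix k n n → Polynomial k
  detₚ {n = zero}  M = con 1ℤ
  detₚ {n = suc n} M = sumₚ (λ j → signₚ (toℕ' j) :* M zero j :* detₚ (λ r c → M (suc r) (punchIn j c)))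

  identityₚ : ∀ {k n} → PolyMatrix k n n
  identityₚ zero    zero    = con 1ℤ
  identityₚ zero    (suc j) = con 0ℤ
  identityₚ (suc i) zero    = con 0ℤ
  identityₚ (suc i) (suc j) = identityₚ i j

  charPolyₚ : ∀ {n} → PolyMatrix 1 n n → Polynomial 1
  charPolyₚ M = detₚ (λ i j → var zero :* identityₚ i j :- M i j)

module Witness (ℝ : RealField) where

  open RealField ℝ
  open Matrices ℝ
  open RealFieldProperties ℝ
  open MatrixProperties ℝ
  open CommutativeRing commutativeRing using (+-identityˡ; +-group; ring)
  open import Algebra.Properties.Ring ring using (-0#≈0#)
  open import Algebra.Properties.Group +-group using (inverseˡ-unique; inverseʳ-unique)

  witnessRows : Vec (Vec ℕ 4) 4
  witnessRows = (3 ∷ 4 ∷ 0 ∷ 0 ∷ [])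
              ∷ (0 ∷ 1 ∷ 1 ∷ 1 ∷ [])
              ∷ (0 ∷ 0 ∷ 5 ∷ 0 ∷ [])
              ∷ (0 ∷ 0 ∷ 0 ∷ 5 ∷ [])
              ∷ []

  witnessEntry : Fin 4 → Fin 4 → ℕ
  witnessEntry i j = lookup (lookup witnessRows i) j

  A : Matrix 4 4
  A i j = fromℕ (witnessEntry i j)

  Aₚ : ∀ {k} → PolyMatrix k 4 4
  Aₚ i j = con (+ witnessEntry i j)

  A-pattern : HasPattern A pattern4
  A-pattern = HasPattern-resp pattern≗ (fromℕ-hasPattern witnessEntry)
    where
    pattern≗ : ∀ i j → (0 ℕ.<ᵇ witnessEntry i j) ≡ pattern4 i j
    pattern≗ i j = begin
      0 ℕ.<ᵇ lookup (lookup witnessRows i) j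
        ≡⟨ lookup-map j (0 ℕ.<ᵇ_) (lookup witnessRows i) ⟨
      lookup (map (0 ℕ.<ᵇ_) (lookup witnessRows i)) j
        ≡⟨ ≡.cong (λ row → lookup row j) (lookup-map i (map (0 ℕ.<ᵇ_)) witnessRows) ⟨
      lookup (lookup (map (map (0 ℕ.<ᵇ_)) witnessRows) i) j
        ∎
      where open ≡.≡-Reasoning

  A-charPoly : ∀ t → charPoly (A · (A ᵀ)) t ≡
               (t + - (fromℕ 5 * fromℕ 5)) * (t + - (fromℕ 5 * fromℕ 5))
                 * evalMonic (fromℕ 9 ∷ - fromℕ 28 ∷ []) t
  A-charPoly t = prove (t ∷ []) (charPolyₚ (Aₚ ·ₚ (Aₚ ᵀₚ)))
    ((t′ :- five :* five) :* (t′ :- five :* five) :* (con (+ 9) :+ t′ :* (:- con (+ 28) :+ t′ :* con 1ℤ)))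
    ≡.refl
    where
    t′ five : Polynomial 1
    t′ = var zero
    five = con (+ 5)

  A-multipleSingularValue : HasMultipleSingularValue A
  A-multipleSingularValue = fromℕ 5 , inj₁ (0<fromℕ-suc 4) , fromℕ 9 ∷ - fromℕ 28 ∷ [] , A-charPoly

  module SSVPCondition (X : Matrix 4 4)
                       (AᵀX-sym : Symmetric ((A ᵀ) · X)) (XAᵀ-sym : Symmetric (X · (A ᵀ)))
                       (A∘X≡0 : IsZero (A ∘ₕ X)) where

    ρ : Vec Carrier 16
    ρ = tabulate (uncurry X ∘ remQuot 4)

    x : Fin 4 → Fin 4 → Polynomial 16
    x i j = var (combine i j)

    Xₚ AᵀXₚ XAᵀₚ : PolyMatrix 16 4 4
    Xₚ i j = if pattern4 i j then con 0ℤ else x i j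
    AᵀXₚ   = (Aₚ ᵀₚ) ·ₚ Xₚ
    XAᵀₚ   = Xₚ ·ₚ (Aₚ ᵀₚ)

    X≗⟦Xₚ⟧ : ∀ i j → X i j ≡ ⟦ Xₚ i j ⟧ ρ
    X≗⟦Xₚ⟧ i j = begin
      X i j                                       ≡⟨ offSupport-exact A-pattern A∘X≡0 i j ⟩
      (if pattern4 i j then 0ℝ else X i j)        ≡⟨ ≡.cong (if pattern4 i j then 0ℝ else_) ⟦x⟧≡X ⟨
      (if pattern4 i j then 0ℝ else ⟦ x i j ⟧ ρ)  ≡⟨ if-float (λ p → ⟦ p ⟧ ρ) (pattern4 i j) ⟨
      ⟦ Xₚ i j ⟧ ρ                                ∎
      where
      open ≡.≡-Reasoning
      ⟦x⟧≡X : ⟦ x i j ⟧ ρ ≡ X i j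
      ⟦x⟧≡X = ≡.trans (lookup∘tabulate (uncurry X ∘ remQuot 4) (combine i j))
                      (≡.cong (uncurry X) (remQuot-combine i j))

    normalise-symmetry : (S : PolyMatrix 16 4 4) → (∀ i j → ⟦ S i j ⟧ ρ ≡ ⟦ S j i ⟧ ρ) →
                         ∀ i j (p q : Polynomial 16) → ⟦ p ⟧↓ ρ ≡ ⟦ S i j ⟧↓ ρ → ⟦ S j i ⟧↓ ρ ≡ ⟦ q ⟧↓ ρ →
                         ⟦ p ⟧ ρ ≡ ⟦ q ⟧ ρ
    normalise-symmetry S S-sym i j p q p≈Sij Sji≈q =
      ≡.trans (prove ρ p (S i j) p≈Sij) (≡.trans (S-sym i j) (prove ρ (S j i) q Sji≈q))

    by-AᵀX-sym : ∀ i j (p q : Polynomial 16) →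
                 ⟦ p ⟧↓ ρ ≡ ⟦ AᵀXₚ i j ⟧↓ ρ → ⟦ AᵀXₚ j i ⟧↓ ρ ≡ ⟦ q ⟧↓ ρ → ⟦ p ⟧ ρ ≡ ⟦ q ⟧ ρ
    by-AᵀX-sym = normalise-symmetry AᵀXₚ (Symmetric-resp (·-congʳ (A ᵀ) X≗⟦Xₚ⟧) AᵀX-sym)

    by-XAᵀ-sym : ∀ i j (p q : Polynomial 16) →
                 ⟦ p ⟧↓ ρ ≡ ⟦ XAᵀₚ i j ⟧↓ ρ → ⟦ XAᵀₚ j i ⟧↓ ρ ≡ ⟦ q ⟧↓ ρ → ⟦ p ⟧ ρ ≡ ⟦ q ⟧ ρ
    by-XAᵀ-sym = normalise-symmetry XAᵀₚ (Symmetric-resp (·-congˡ (A ᵀ) X≗⟦Xₚ⟧) XAᵀ-sym)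

    x₁₀≡0 : X 1F 0F ≡ 0ℝ
    x₁₀≡0 = by-AᵀX-sym 1F 0F (x 1F 0F) (con 0ℤ) ≡.refl ≡.refl

    x₀₂+x₀₃≡3x₁₀ : X 0F 2F + X 0F 3F ≡ fromℕ 3 * X 1F 0F
    x₀₂+x₀₃≡3x₁₀ = by-XAᵀ-sym 0F 1F (x 0F 2F :+ x 0F 3F) (con (+ 3) :* x 1F 0F) ≡.refl ≡.refl

    4x₀₂≡5x₂₁ : fromℕ 4 * X 0F 2F ≡ fromℕ 5 * X 2F 1F
    4x₀₂≡5x₂₁ = by-AᵀX-sym 1F 2F (con (+ 4) :* x 0F 2F) (con (+ 5) :* x 2F 1F) ≡.refl ≡.refl

    4x₀₃≡5x₃₁ : fromℕ 4 * X 0F 3F ≡ fromℕ 5 * X 3F 1F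
    4x₀₃≡5x₃₁ = by-AᵀX-sym 1F 3F (con (+ 4) :* x 0F 3F) (con (+ 5) :* x 3F 1F) ≡.refl ≡.refl

    x₂₁+x₂₃≡0 : X 2F 1F + X 2F 3F ≡ 0ℝ
    x₂₁+x₂₃≡0 = by-XAᵀ-sym 2F 1F (x 2F 1F :+ x 2F 3F) (con 0ℤ) ≡.refl ≡.refl

    x₃₁+x₃₂≡0 : X 3F 1F + X 3F 2F ≡ 0ℝ
    x₃₁+x₃₂≡0 = by-XAᵀ-sym 3F 1F (x 3F 1F :+ x 3F 2F) (con 0ℤ) ≡.refl ≡.refl

    x₂₃≡x₃₂ : X 2F 3F ≡ X 3F 2F
    x₂₃≡x₃₂ = *-cancelˡ (fromℕ-suc≢0 4)
      (by-XAᵀ-sym 2F 3F (con (+ 5) :* x 2F 3F) (con (+ 5) :* x 3F 2F) ≡.refl ≡.refl)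

    3x₀₂≡x₁₀+5x₂₀ : fromℕ 3 * X 0F 2F ≡ X 1F 0F + fromℕ 5 * X 2F 0F
    3x₀₂≡x₁₀+5x₂₀ = by-AᵀX-sym 0F 2F (con (+ 3) :* x 0F 2F) (x 1F 0F :+ con (+ 5) :* x 2F 0F) ≡.refl ≡.refl

    3x₀₃≡x₁₀+5x₃₀ : fromℕ 3 * X 0F 3F ≡ X 1F 0F + fromℕ 5 * X 3F 0F
    3x₀₃≡x₁₀+5x₃₀ = by-AᵀX-sym 0F 3F (con (+ 3) :* x 0F 3F) (x 1F 0F :+ con (+ 5) :* x 3F 0F) ≡.refl ≡.refl

    open ≡.≡-Reasoning

    4x₀₂≡4x₀₃ : fromℕ 4 * X 0F 2F ≡ fromℕ 4 * X 0F 3F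
    4x₀₂≡4x₀₃ = begin
      fromℕ 4 * X 0F 2F    ≡⟨ 4x₀₂≡5x₂₁ ⟩
      fromℕ 5 * X 2F 1F    ≡⟨ ≡.cong (fromℕ 5 *_) (inverseˡ-unique _ _ x₂₁+x₂₃≡0) ⟩
      fromℕ 5 * - X 2F 3F  ≡⟨ ≡.cong (λ z → fromℕ 5 * - z) x₂₃≡x₃₂ ⟩
      fromℕ 5 * - X 3F 2F  ≡⟨ ≡.cong (fromℕ 5 *_) (inverseˡ-unique _ _ x₃₁+x₃₂≡0) ⟨
      fromℕ 5 * X 3F 1F    ≡⟨ 4x₀₃≡5x₃₁ ⟨
      fromℕ 4 * X 0F 3F    ∎

    x₀₂≡x₀₃ : X 0F 2F ≡ X 0F 3F
    x₀₂≡x₀₃ = *-cancelˡ (fromℕ-suc≢0 3) 4x₀₂≡4x₀₃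

    x₀₂≡0 : X 0F 2F ≡ 0ℝ
    x₀₂≡0 = x+x≡0⇒x≡0 (begin
      X 0F 2F + X 0F 2F  ≡⟨ ≡.cong₂ _+_ ≡.refl x₀₂≡x₀₃ ⟩
      X 0F 2F + X 0F 3F  ≡⟨ x₀₂+x₀₃≡3x₁₀ ⟩
      fromℕ 3 * X 1F 0F  ≡⟨ x≡0⇒a*x≡0 (fromℕ 3) x₁₀≡0 ⟩
      0ℝ                 ∎)

    x₀₃≡0 : X 0F 3F ≡ 0ℝ
    x₀₃≡0 = ≡.trans (≡.sym x₀₂≡x₀₃) x₀₂≡0

    x₂₁≡0 : X 2F 1F ≡ 0ℝ
    x₂₁≡0 = a*x≡0⇒x≡0 (fromℕ-suc≢0 4) (≡.trans (≡.sym 4x₀₂≡5x₂₁) (x≡0⇒a*x≡0 (fromℕ 4) x₀₂≡0))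

    x₃₁≡0 : X 3F 1F ≡ 0ℝ
    x₃₁≡0 = a*x≡0⇒x≡0 (fromℕ-suc≢0 4) (≡.trans (≡.sym 4x₀₃≡5x₃₁) (x≡0⇒a*x≡0 (fromℕ 4) x₀₃≡0))

    x₂₃≡0 : X 2F 3F ≡ 0ℝ
    x₂₃≡0 = begin
      X 2F 3F    ≡⟨ inverseʳ-unique _ _ x₂₁+x₂₃≡0 ⟩
      - X 2F 1F  ≡⟨ ≡.cong -_ x₂₁≡0 ⟩
      - 0ℝ       ≡⟨ -0#≈0# ⟩
      0ℝ         ∎

    x₃₂≡0 : X 3F 2F ≡ 0ℝ
    x₃₂≡0 = ≡.trans (≡.sym x₂₃≡x₃₂) x₂₃≡0

    x₂₀≡0 : X 2F 0F ≡ 0ℝ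
    x₂₀≡0 = a*x≡0⇒x≡0 (fromℕ-suc≢0 4) (begin
      fromℕ 5 * X 2F 0F            ≡⟨ +-identityˡ _ ⟨
      0ℝ + fromℕ 5 * X 2F 0F       ≡⟨ ≡.cong (_+ fromℕ 5 * X 2F 0F) x₁₀≡0 ⟨
      X 1F 0F + fromℕ 5 * X 2F 0F  ≡⟨ 3x₀₂≡x₁₀+5x₂₀ ⟨
      fromℕ 3 * X 0F 2F            ≡⟨ x≡0⇒a*x≡0 (fromℕ 3) x₀₂≡0 ⟩
      0ℝ                           ∎)

    x₃₀≡0 : X 3F 0F ≡ 0ℝ
    x₃₀≡0 = a*x≡0⇒x≡0 (fromℕ-suc≢0 4) (begin
      fromℕ 5 * X 3F 0F            ≡⟨ +-identityˡ _ ⟨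
      0ℝ + fromℕ 5 * X 3F 0F       ≡⟨ ≡.cong (_+ fromℕ 5 * X 3F 0F) x₁₀≡0 ⟨
      X 1F 0F + fromℕ 5 * X 3F 0F  ≡⟨ 3x₀₃≡x₁₀+5x₃₀ ⟨
      fromℕ 3 * X 0F 3F            ≡⟨ x≡0⇒a*x≡0 (fromℕ 3) x₀₃≡0 ⟩
      0ℝ                           ∎)

    ⟦Xₚ⟧≡0 : ∀ i j → ⟦ Xₚ i j ⟧ ρ ≡ 0ℝ
    ⟦Xₚ⟧≡0 0F 0F = ≡.refl ; ⟦Xₚ⟧≡0 0F 1F = ≡.refl ; ⟦Xₚ⟧≡0 0F 2F = x₀₂≡0  ; ⟦Xₚ⟧≡0 0F 3F = x₀₃≡0
    ⟦Xₚ⟧≡0 1F 0F = x₁₀≡0  ; ⟦Xₚ⟧≡0 1F 1F = ≡.refl ; ⟦Xₚ⟧≡0 1F 2F = ≡.refl ; ⟦Xₚ⟧≡0 1F 3F = ≡.refl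
    ⟦Xₚ⟧≡0 2F 0F = x₂₀≡0  ; ⟦Xₚ⟧≡0 2F 1F = x₂₁≡0  ; ⟦Xₚ⟧≡0 2F 2F = ≡.refl ; ⟦Xₚ⟧≡0 2F 3F = x₂₃≡0
    ⟦Xₚ⟧≡0 3F 0F = x₃₀≡0  ; ⟦Xₚ⟧≡0 3F 1F = x₃₁≡0  ; ⟦Xₚ⟧≡0 3F 2F = x₃₂≡0  ; ⟦Xₚ⟧≡0 3F 3F = ≡.refl

    X≡0 : IsZero X
    X≡0 i j = ≡.trans (X≗⟦Xₚ⟧ i j) (⟦Xₚ⟧≡0 i j)

  A-SSVP : SSVP A
  A-SSVP = SSVPCondition.X≡0

lemma2p8 : (R : RealField) → let open Matrices R in
    ∃ λ (A : Matrix 4 4) → HasPattern A pattern4 × SSVP A × HasMultipleSingularValue A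
lemma2p8 R = A , A-pattern , A-SSVP , A-multipleSingularValue
  where open Witness R
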